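{- Let $s\ge1$ and let $\tau=\tau^1\mbox{ - }\tau^2\mbox{ - }\cdots\mbox{ - }\tau^s$ be a multi-pattern such that each $\tau^j$ is equal to either $12$ or $21$. Then for $k\ge1$, $$A_\tau(x;k)=\frac{1-\left(1+\frac{kx-1}{(1-x)^k}\right)^s}{1-kx}.$$
   Context: $[k]^n$ = words of length $n$ over $\{1,\dots,k\}$. A multi-pattern $\tau^1\mbox{ - }\cdots\mbox{ - }\tau^s$ (each $\tau^i$ a generalized pattern with no hyphens, i.e. a word over $[m]$ using all letters of $[m]$) is contained in a word $\sigma$ if $\sigma$ has occurrences of $\tau^1,\dots,\tau^s$ in this left-to-right order, pairwise non-overlapping, where an occurrence of a hyphen-free block is a factor of consecutive letters order-isomorphic to it (letters from different blocks are incomparable, so no relation between blocks is required); otherwise $\sigma$ avoids it. $A_\tau(x;k)=\sum_{n\ge0}a_\tau(n;k)x^n$ with $a_\tau(n;k)$ the number of words in $[k]^n$ avoiding $\tau$. -}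

module Defs where

open import Data.Bool using (Bool; true; false; _∧_; _∨_; not)
open import Data.Nat as ℕ using (ℕ; zero; suc; _<ᵇ_)
open import Data.Integer as ℤ using (ℤ; +_; _+_; _*_; -_; _-_)
open import Data.Fin using (Fin; toℕ)
open import Data.List using (List; []; _∷_; [_]; map; concatMap; allFin; filterᵇ; length)
open import Data.Vec using (Vec) renaming ([] to []ᵛ; _∷_ to _∷ᵛ_)
import Data.Vec as Vec

-- All words of length n over [k] (letters Fin k, i.e. {1..k} shifted by one).
allWords : (k n : ℕ) → List (Vec (Fin k) n)
allWords k zero    = [ []ᵛ ]
allWords k (suc n) = concatMap (λ a → map (a ∷ᵛ_) (allWords k n)) (allFin k)

data Block2 : Set where
  p12 p21 : Block2

matches : ∀ {k} → Block2 → Fin k → Fin k → Bool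
matches p12 x y = toℕ x <ᵇ toℕ y
matches p21 x y = toℕ y <ᵇ toℕ x

-- A multi-pattern τ¹-τ²-…-τˢ with each τʲ ∈ {12, 21} is a list of blocks.
-- containsL τ w = true iff w contains occurrences of τ¹,…,τˢ in this
-- left-to-right order, pairwise non-overlapping (each an adjacent factor).
containsL : ∀ {k} → List Block2 → List (Fin k) → Bool
containsL []       w           = true
containsL (b ∷ bs) []          = false
containsL (b ∷ bs) (x ∷ [])    = false
containsL (b ∷ bs) (x ∷ y ∷ w) =
  (matches b x y ∧ containsL bs w) ∨ containsL (b ∷ bs) (y ∷ w)

avoids : ∀ {k n} → List Block2 → Vec (Fin k) n → Bool
avoids τ σ = not (containsL τ (Vec.toList σ))

avoidCount : List Block2 → (k n : ℕ) → ℕ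
avoidCount τ k n = length (filterᵇ (avoids τ) (allWords k n))

infixl 6 _⊕_ _⊖_
infixl 7 _⊗_
infixr 8 _^ˢ_

Series : Set
Series = ℕ → ℤ

const : ℤ → Series
const c zero    = c
const c (suc _) = + 0

X : Series
X 1 = + 1
X _ = + 0

_⊕_ : Series → Series → Series
(f ⊕ g) n = f n + g n

_⊖_ : Series → Series → Series
(f ⊖ g) n = f n - g n

-- Cauchy product: (f ⊗ g) n = Σ_{i=0}^{n} f i * g (n - i)
convSum : Series → Series → ℕ → ℕ → ℤ
convSum f g zero    j = f zero * g j
convSum f g (suc i) j = f (suc i) * g j + convSum f g i (suc j)

_⊗_ : Series → Series → Series
(f ⊗ g) n = convSum f g n zero

_^ˢ_ : Series → ℕ → Series
f ^ˢ zero  = const (+ 1)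
f ^ˢ suc m = f ⊗ (f ^ˢ m)

-- Multiplicative inverse of a series with constant term 1:
-- b₀ = 1, b_{n} = - Σ_{i=1}^{n} a_i b_{n-i}.
-- invRev a n = b_n ∷ b_{n-1} ∷ … ∷ b₀.
private
  step : Series → ℕ → List ℤ → ℤ
  step a p []       = + 0
  step a p (r ∷ rs) = a (suc p) * r + step a (suc p) rs

invRev : Series → ℕ → List ℤ
invRev a zero    = [ + 1 ]
invRev a (suc n) = (- step a 0 rs) ∷ rs
  where rs = invRev a n

inv : Series → Series
inv a n with invRev a n
... | []    = + 0
... | b ∷ _ = b

{-# OPTIONS --safe #-}

-- Write L = 1 - kx, let A_σ be the generating function of the words avoiding
-- the multi-pattern σ and put H_σ = 1 - L A_σ, so that H_σ = 1 for the empty σ.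
-- Let σ = b-ρ and let c(x) be the number of letters y for which x y is not an
-- occurrence of b. A word x y w avoids σ iff w avoids ρ when x y is an occurrence
-- of b, and iff y w avoids σ otherwise. The letters y of the second kind are
-- those with c(y) ≤ c(x), and c maps the letters bijectively onto 1, …, k. As
-- [xⁿ⁺¹] (1 - x)⁻ᶜ = Σ_{i ≤ c} [xⁿ] (1 - x)⁻ⁱ, induction on the length of w shows
-- that the words x w avoiding σ have generating function A_ρ + (1 - x)^(-c(x)) H_ρ.
-- Summing over x gives A_σ = A_ρ + (1 - x)⁻ᵏ H_ρ, that is H_σ = P H_ρ with
-- P = 1 - L (1 - x)⁻ᵏ = 1 + (kx - 1)/(1 - x)ᵏ. Hence H_τ = Pˢ and A_τ = (1 - Pˢ)/L.

module Submission where

open import Defs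
open import Data.Nat using (ℕ; _≤_)
open import Data.Integer using (+_)
open import Data.List using (List; length)
open import Relation.Binary.PropositionalEquality using (_≡_)

open import Data.Integer using (ℤ; _+_; _*_; -_; _-_)
import Data.Integer.Properties as ℤ
open import Algebra.Properties.CommutativeSemigroup ℤ.+-commutativeSemigroup
  using (interchange; x∙yz≈y∙xz)
open import Data.Integer.Tactic.RingSolver using (solve-∀)
open import Data.Nat as ℕ using (zero; suc; _∸_)
import Data.Nat.Properties as ℕ
open import Data.List using ([]; _∷_; _++_; map; concatMap; tabulate; filterᵇ)
import Data.List.Properties as List
open import Data.Bool using (Bool; true; false; not; _∨_; T; if_then_else_)
open import Data.Bool.Properties using (∨-zeroʳ)
open import Data.Fin using (Fin; toℕ) renaming (zero to fzero; suc to fsuc)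
open import Data.Product using (_,_)
open import Data.Vec using (Vec; toList) renaming (_∷_ to _∷ᵛ_)
open import Relation.Nullary.Decidable using (T?)
open import Relation.Unary using (_≐_)
open import Function using (_∘_; id)
open import Algebra.Properties.CommutativeMonoid.Sum ℤ.+-0-commutativeMonoid
  using (sum-syntax; sum-cong-≗; sum-replicate-zero; ∑-distrib-+)
open import Relation.Binary.PropositionalEquality
  using (refl; sym; trans; cong; cong₂; subst; _≗_; _→-setoid_; module ≡-Reasoning)
import Relation.Binary.Reasoning.Setoid as SetoidReasoning

module ≗-Reasoning = SetoidReasoning (ℕ →-setoid ℤ)

-- Formal power series

infixr 7 _·_

tail : Series → Series
tail f n = f (suc n)

_·_ : ℤ → Series → Series
(c · f) n = c * f n

convSum-cong : ∀ {f f′ g g′} → f ≗ f′ → g ≗ g′ → ∀ i j → convSum f g i j ≡ convSum f′ g′ i j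
convSum-cong f≗f′ g≗g′ zero    j = cong₂ _*_ (f≗f′ 0) (g≗g′ j)
convSum-cong f≗f′ g≗g′ (suc i) j =
  cong₂ _+_ (cong₂ _*_ (f≗f′ (suc i)) (g≗g′ j)) (convSum-cong f≗f′ g≗g′ i (suc j))

⊗-cong : ∀ {f f′ g g′} → f ≗ f′ → g ≗ g′ → f ⊗ g ≗ f′ ⊗ g′
⊗-cong f≗f′ g≗g′ n = convSum-cong f≗f′ g≗g′ n 0

⊗-congˡ : ∀ {f f′} g → f ≗ f′ → f ⊗ g ≗ f′ ⊗ g
⊗-congˡ g f≗f′ = ⊗-cong f≗f′ (λ _ → refl)

⊗-congʳ : ∀ f {g g′} → g ≗ g′ → f ⊗ g ≗ f ⊗ g′
⊗-congʳ f = ⊗-cong (λ _ → refl)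

⊕-congʳ : ∀ f {g g′} → g ≗ g′ → f ⊕ g ≗ f ⊕ g′
⊕-congʳ f g≗g′ n = cong (_+_ (f n)) (g≗g′ n)

⊖-cong : ∀ {f f′ g g′} → f ≗ f′ → g ≗ g′ → f ⊖ g ≗ f′ ⊖ g′
⊖-cong f≗f′ g≗g′ n = cong₂ _-_ (f≗f′ n) (g≗g′ n)

⊖-congʳ : ∀ f {g g′} → g ≗ g′ → f ⊖ g ≗ f ⊖ g′
⊖-congʳ f = ⊖-cong {f} (λ _ → refl)

convSum-sucʳ : ∀ f g i j → convSum f g i (suc j) ≡ convSum f (tail g) i j
convSum-sucʳ f g zero    j = refl
convSum-sucʳ f g (suc i) j = cong (_+_ (f (suc i) * g (suc j))) (convSum-sucʳ f g i (suc j))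

⊗-sucʳ : ∀ f g n → (f ⊗ g) (suc n) ≡ f (suc n) * g 0 + (f ⊗ tail g) n
⊗-sucʳ f g n = cong (_+_ (f (suc n) * g 0)) (convSum-sucʳ f g n 0)

convSum-sucˡ : ∀ f g i j → convSum f g (suc i) j ≡ f 0 * g (suc (i ℕ.+ j)) + convSum (tail f) g i j
convSum-sucˡ f g zero    j = ℤ.+-comm (f 1 * g j) (f 0 * g (suc j))
convSum-sucˡ f g (suc i) j = begin
    f (suc (suc i)) * g j + convSum f g (suc i) (suc j)
  ≡⟨ cong (_+_ (f (suc (suc i)) * g j)) (convSum-sucˡ f g i (suc j)) ⟩
    f (suc (suc i)) * g j + (f 0 * g (suc (i ℕ.+ suc j)) + convSum (tail f) g i (suc j))
  ≡⟨ cong (λ m → f (suc (suc i)) * g j + (f 0 * g (suc m) + convSum (tail f) g i (suc j))) (ℕ.+-suc i j) ⟩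
    f (suc (suc i)) * g j + (f 0 * g (suc (suc i ℕ.+ j)) + convSum (tail f) g i (suc j))
  ≡⟨ x∙yz≈y∙xz (f (suc (suc i)) * g j) (f 0 * g (suc (suc i ℕ.+ j))) _ ⟩
    f 0 * g (suc (suc i ℕ.+ j)) + convSum (tail f) g (suc i) j
  ∎
  where open ≡-Reasoning

⊗-sucˡ : ∀ f g n → (f ⊗ g) (suc n) ≡ f 0 * g (suc n) + (tail f ⊗ g) n
⊗-sucˡ f g n = trans (convSum-sucˡ f g n 0)
  (cong (λ m → f 0 * g (suc m) + (tail f ⊗ g) n) (ℕ.+-identityʳ n))

⊗-comm : ∀ f g → f ⊗ g ≗ g ⊗ f
⊗-comm f g zero    = ℤ.*-comm (f 0) (g 0)
⊗-comm f g (suc n) = begin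
  (f ⊗ g) (suc n)                   ≡⟨ ⊗-sucˡ f g n ⟩
  f 0 * g (suc n) + (tail f ⊗ g) n  ≡⟨ cong₂ _+_ (ℤ.*-comm (f 0) (g (suc n))) (⊗-comm (tail f) g n) ⟩
  g (suc n) * f 0 + (g ⊗ tail f) n  ≡⟨ ⊗-sucʳ g f n ⟨
  (g ⊗ f) (suc n)                   ∎
  where open ≡-Reasoning

convSum-⊕ˡ : ∀ f g h i j → convSum (f ⊕ g) h i j ≡ convSum f h i j + convSum g h i j
convSum-⊕ˡ f g h zero    j = ℤ.*-distribʳ-+ (h j) (f 0) (g 0)
convSum-⊕ˡ f g h (suc i) j =
  trans (cong₂ _+_ (ℤ.*-distribʳ-+ (h j) (f (suc i)) (g (suc i))) (convSum-⊕ˡ f g h i (suc j)))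
        (interchange (f (suc i) * h j) (g (suc i) * h j) (convSum f h i (suc j)) (convSum g h i (suc j)))

convSum-⊖ˡ : ∀ f g h i j → convSum (f ⊖ g) h i j ≡ convSum f h i j - convSum g h i j
convSum-⊖ˡ f g h zero    j = *-distribʳ-- (f 0) (g 0) (h j)
  where
  *-distribʳ-- : ∀ a b c → (a - b) * c ≡ a * c - b * c
  *-distribʳ-- = solve-∀
convSum-⊖ˡ f g h (suc i) j =
  trans (cong (_+_ ((f (suc i) - g (suc i)) * h j)) (convSum-⊖ˡ f g h i (suc j)))
        (regroup (f (suc i)) (g (suc i)) (h j) _ _)
  where
  regroup : ∀ a b c d e → (a - b) * c + (d - e) ≡ (a * c + d) - (b * c + e)
  regroup = solve-∀

convSum-·ˡ : ∀ c f g i j → convSum (c · f) g i j ≡ c * convSum f g i j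
convSum-·ˡ c f g zero    j = ℤ.*-assoc c (f 0) (g j)
convSum-·ˡ c f g (suc i) j =
  trans (cong₂ _+_ (ℤ.*-assoc c (f (suc i)) (g j)) (convSum-·ˡ c f g i (suc j)))
        (sym (ℤ.*-distribˡ-+ c _ _))

⊗-distribʳ-⊕ : ∀ f g h → (f ⊕ g) ⊗ h ≗ f ⊗ h ⊕ g ⊗ h
⊗-distribʳ-⊕ f g h n = convSum-⊕ˡ f g h n 0

⊗-distribʳ-⊖ : ∀ f g h → (f ⊖ g) ⊗ h ≗ f ⊗ h ⊖ g ⊗ h
⊗-distribʳ-⊖ f g h n = convSum-⊖ˡ f g h n 0

⊗-distribˡ-⊕ : ∀ f g h → f ⊗ (g ⊕ h) ≗ f ⊗ g ⊕ f ⊗ h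
⊗-distribˡ-⊕ f g h n = begin
  (f ⊗ (g ⊕ h)) n             ≡⟨ ⊗-comm f (g ⊕ h) n ⟩
  ((g ⊕ h) ⊗ f) n             ≡⟨ ⊗-distribʳ-⊕ g h f n ⟩
  (g ⊗ f) n + (h ⊗ f) n       ≡⟨ cong₂ _+_ (⊗-comm g f n) (⊗-comm h f n) ⟩
  (f ⊗ g) n + (f ⊗ h) n       ∎
  where open ≡-Reasoning

·-⊗ : ∀ c f g → (c · f) ⊗ g ≗ c · (f ⊗ g)
·-⊗ c f g n = convSum-·ˡ c f g n 0

convSum-zeroˡ : ∀ g i j → convSum (λ _ → + 0) g i j ≡ + 0
convSum-zeroˡ g zero    j = refl
convSum-zeroˡ g (suc i) j = trans (ℤ.+-identityˡ _) (convSum-zeroˡ g i (suc j))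

⊗-zeroˡ : ∀ f → (λ _ → + 0) ⊗ f ≗ (λ _ → + 0)
⊗-zeroˡ f n = convSum-zeroˡ f n 0

const-⊗ : ∀ c f → const c ⊗ f ≗ c · f
const-⊗ c f zero    = refl
const-⊗ c f (suc n) = begin
  (const c ⊗ f) (suc n)            ≡⟨ ⊗-sucʳ (const c) f n ⟩
  + 0 * f 0 + (const c ⊗ tail f) n ≡⟨ cong (_+_ (+ 0 * f 0)) (const-⊗ c (tail f) n) ⟩
  + 0 + c * f (suc n)              ≡⟨ ℤ.+-identityˡ _ ⟩
  c * f (suc n)                    ∎
  where open ≡-Reasoning

⊗-identityˡ : ∀ f → const (+ 1) ⊗ f ≗ f
⊗-identityˡ f n = trans (const-⊗ (+ 1) f n) (ℤ.*-identityˡ (f n))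

⊗-identityʳ : ∀ f → f ⊗ const (+ 1) ≗ f
⊗-identityʳ f n = trans (⊗-comm f (const (+ 1)) n) (⊗-identityˡ f n)

⊗-assoc : ∀ f g h → (f ⊗ g) ⊗ h ≗ f ⊗ (g ⊗ h)
⊗-assoc f g h zero    = ℤ.*-assoc (f 0) (g 0) (h 0)
⊗-assoc f g h (suc n) = begin
    ((f ⊗ g) ⊗ h) (suc n)
  ≡⟨ ⊗-sucˡ (f ⊗ g) h n ⟩
    f 0 * g 0 * h (suc n) + (tail (f ⊗ g) ⊗ h) n
  ≡⟨ cong (_+_ (f 0 * g 0 * h (suc n))) (⊗-congˡ h (⊗-sucˡ f g) n) ⟩
    f 0 * g 0 * h (suc n) + ((f 0 · tail g ⊕ tail f ⊗ g) ⊗ h) n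
  ≡⟨ cong (_+_ (f 0 * g 0 * h (suc n))) (⊗-distribʳ-⊕ (f 0 · tail g) (tail f ⊗ g) h n) ⟩
    f 0 * g 0 * h (suc n) + (((f 0 · tail g) ⊗ h) n + ((tail f ⊗ g) ⊗ h) n)
  ≡⟨ cong (_+_ (f 0 * g 0 * h (suc n))) (cong₂ _+_ (·-⊗ (f 0) (tail g) h n) (⊗-assoc (tail f) g h n)) ⟩
    f 0 * g 0 * h (suc n) + (f 0 * (tail g ⊗ h) n + (tail f ⊗ (g ⊗ h)) n)
  ≡⟨ factor (f 0) (g 0) (h (suc n)) _ _ ⟩
    f 0 * (g 0 * h (suc n) + (tail g ⊗ h) n) + (tail f ⊗ (g ⊗ h)) n
  ≡⟨ cong (λ x → f 0 * x + (tail f ⊗ (g ⊗ h)) n) (⊗-sucˡ g h n) ⟨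
    f 0 * (g ⊗ h) (suc n) + (tail f ⊗ (g ⊗ h)) n
  ≡⟨ ⊗-sucˡ f (g ⊗ h) n ⟨
    (f ⊗ (g ⊗ h)) (suc n)
  ∎
  where
  open ≡-Reasoning
  factor : ∀ a b c d e → a * b * c + (a * d + e) ≡ a * (b * c + d) + e
  factor = solve-∀

^ˢ-cong : ∀ {f f′} m → f ≗ f′ → f ^ˢ m ≗ f′ ^ˢ m
^ˢ-cong zero    f≗f′ n = refl
^ˢ-cong (suc m) f≗f′   = ⊗-cong f≗f′ (^ˢ-cong m f≗f′)

^ˢ-constant-term : ∀ f m → f 0 ≡ + 1 → (f ^ˢ m) 0 ≡ + 1
^ˢ-constant-term f zero    f₀≡1 = refl
^ˢ-constant-term f (suc m) f₀≡1 = cong₂ _*_ f₀≡1 (^ˢ-constant-term f m f₀≡1)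

-- Inverses

invStep : Series → ℕ → List ℤ → ℤ
invStep a p []       = + 0
invStep a p (r ∷ rs) = a (suc p) * r + invStep a (suc p) rs

invStep-unique : ∀ a (G : ℕ → List ℤ → ℤ) → (∀ p → G p [] ≡ + 0) →
                 (∀ p r rs → G p (r ∷ rs) ≡ a (suc p) * r + G (suc p) rs) →
                 ∀ p rs → G p rs ≡ invStep a p rs
invStep-unique a G G[] G∷ p []       = G[] p
invStep-unique a G G[] G∷ p (r ∷ rs) =
  trans (G∷ p r rs) (cong (_+_ (a (suc p) * r)) (invStep-unique a G G[] G∷ (suc p) rs))

-- The recursion behind inv uses a function that is private to Defs. It is
-- recovered as the solution G of the equations of invStep-unique, which
-- unification finds once its arguments have been abstracted to variables.
inv-suc : ∀ a n → inv a (suc n) ≡ - invStep a 0 (invRev a n)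
inv-suc a n with invRev a n | 0 | invStep-unique a _ (λ _ → refl) (λ _ _ _ → refl)
... | rs | p | step≡invStep = cong -_ (step≡invStep p rs)

invStep-invRev : ∀ a p i → invStep a p (invRev a i) ≡ convSum (inv a) a i (suc p)
invStep-invRev a p zero    = trans (ℤ.+-identityʳ _) (ℤ.*-comm (a (suc p)) (+ 1))
invStep-invRev a p (suc i) =
  cong₂ _+_ (ℤ.*-comm (a (suc p)) (inv a (suc i))) (invStep-invRev a (suc p) i)

inv-⊗ : ∀ a → a 0 ≡ + 1 → inv a ⊗ a ≗ const (+ 1)
inv-⊗ a a₀≡1 zero    = trans (ℤ.*-identityˡ (a 0)) a₀≡1
inv-⊗ a a₀≡1 (suc n) = begin
    inv a (suc n) * a 0 + convSum (inv a) a n 1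
  ≡⟨ cong₂ (λ x y → x * y + convSum (inv a) a n 1) (inv-suc a n) a₀≡1 ⟩
    - s * + 1 + convSum (inv a) a n 1
  ≡⟨ cong (_+_ (- s * + 1)) (invStep-invRev a 0 n) ⟨
    - s * + 1 + s
  ≡⟨ cancel s ⟩
    + 0
  ∎
  where
  open ≡-Reasoning
  s : ℤ
  s = invStep a 0 (invRev a n)
  cancel : ∀ x → - x * + 1 + x ≡ + 0
  cancel = solve-∀

⊗-inv : ∀ a → a 0 ≡ + 1 → a ⊗ inv a ≗ const (+ 1)
⊗-inv a a₀≡1 n = trans (⊗-comm a (inv a) n) (inv-⊗ a a₀≡1 n)

a⊗b≗1⇒inv-a≗b : ∀ a b → a 0 ≡ + 1 → a ⊗ b ≗ const (+ 1) → inv a ≗ b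
a⊗b≗1⇒inv-a≗b a b a₀≡1 a⊗b≗1 = begin
  inv a                    ≈⟨ ⊗-identityʳ (inv a) ⟨
  inv a ⊗ const (+ 1)      ≈⟨ ⊗-congʳ (inv a) a⊗b≗1 ⟨
  inv a ⊗ (a ⊗ b)          ≈⟨ ⊗-assoc (inv a) a b ⟨
  (inv a ⊗ a) ⊗ b          ≈⟨ ⊗-congˡ b (inv-⊗ a a₀≡1) ⟩
  const (+ 1) ⊗ b          ≈⟨ ⊗-identityˡ b ⟩
  b                        ∎
  where open ≗-Reasoning

a⊗f≗g⇒f≗g⊗inv-a : ∀ a f g → a 0 ≡ + 1 → a ⊗ f ≗ g → f ≗ g ⊗ inv a
a⊗f≗g⇒f≗g⊗inv-a a f g a₀≡1 a⊗f≗g = begin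
  f                        ≈⟨ ⊗-identityʳ f ⟨
  f ⊗ const (+ 1)          ≈⟨ ⊗-congʳ f (⊗-inv a a₀≡1) ⟨
  f ⊗ (a ⊗ inv a)          ≈⟨ ⊗-assoc f a (inv a) ⟨
  (f ⊗ a) ⊗ inv a          ≈⟨ ⊗-congˡ (inv a) (⊗-comm f a) ⟩
  (a ⊗ f) ⊗ inv a          ≈⟨ ⊗-congˡ (inv a) a⊗f≗g ⟩
  g ⊗ inv a                ∎
  where open ≗-Reasoning

∑₁ : ℕ → (ℕ → ℤ) → ℤ
∑₁ j G = ∑[ i < j ] G (suc (toℕ i))

∑₁-suc : ∀ j G → ∑₁ (suc j) G ≡ ∑₁ j G + G (suc j)
∑₁-suc zero    G = ℤ.+-comm (G 1) (+ 0)
∑₁-suc (suc j) G = begin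
  G 1 + ∑₁ (suc j) (G ∘ suc)                ≡⟨ cong (_+_ (G 1)) (∑₁-suc j (G ∘ suc)) ⟩
  G 1 + (∑₁ j (G ∘ suc) + G (suc (suc j)))  ≡⟨ ℤ.+-assoc (G 1) _ _ ⟨
  G 1 + ∑₁ j (G ∘ suc) + G (suc (suc j))    ∎
  where open ≡-Reasoning

∑-const : ∀ m a → ∑[ i < m ] a ≡ + m * a
∑-const zero    a = sym (ℤ.*-zeroˡ a)
∑-const (suc m) a = begin
  a + ∑[ i < m ] a        ≡⟨ cong (_+_ a) (∑-const m a) ⟩
  a + + m * a             ≡⟨ cong (_+ + m * a) (ℤ.*-identityˡ a) ⟨
  + 1 * a + + m * a       ≡⟨ ℤ.*-distribʳ-+ a (+ 1) (+ m) ⟨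
  + suc m * a             ∎
  where open ≡-Reasoning

∑-split : ∀ k a (g : Fin k → ℤ) → ∑[ y < k ] (a + g y) ≡ + k * a + ∑[ y < k ] g y
∑-split k a g = trans (∑-distrib-+ (λ _ → a) g) (cong (_+ ∑[ y < k ] g y) (∑-const k a))

∑₁-⊗ : ∀ j (F : ℕ → Series) h → (λ n → ∑₁ j (λ i → F i n)) ⊗ h ≗ (λ n → ∑₁ j (λ i → (F i ⊗ h) n))
∑₁-⊗ zero    F h   = ⊗-zeroˡ h
∑₁-⊗ (suc j) F h n = trans (⊗-distribʳ-⊕ (F 1) (λ m → ∑₁ j (λ i → F (suc i) m)) h n)
                           (cong (_+_ ((F 1 ⊗ h) n)) (∑₁-⊗ j (F ∘ suc) h n))

-- (1 - x)⁻ʲ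
geomPow : ℕ → Series
geomPow zero    n       = const (+ 1) n
geomPow (suc j) zero    = + 1
geomPow (suc j) (suc n) = geomPow j (suc n) + geomPow (suc j) n

geomPow-0 : ∀ j → geomPow j 0 ≡ + 1
geomPow-0 zero    = refl
geomPow-0 (suc j) = refl

geomPow-suc : ∀ j n → geomPow j (suc n) ≡ ∑₁ j (λ i → geomPow i n)
geomPow-suc zero    n = refl
geomPow-suc (suc j) n = trans (cong (_+ geomPow (suc j) n) (geomPow-suc j n))
                              (sym (∑₁-suc j (λ i → geomPow i n)))

[1-x]⊗geomPow-suc : ∀ j → (const (+ 1) ⊖ X) ⊗ geomPow (suc j) ≗ geomPow j
[1-x]⊗geomPow-suc j zero    = sym (geomPow-0 j)
[1-x]⊗geomPow-suc j (suc n) = begin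
    ((const (+ 1) ⊖ X) ⊗ geomPow (suc j)) (suc n)
  ≡⟨ ⊗-sucˡ (const (+ 1) ⊖ X) (geomPow (suc j)) n ⟩
    + 1 * (geomPow j (suc n) + geomPow (suc j) n) + (tail (const (+ 1) ⊖ X) ⊗ geomPow (suc j)) n
  ≡⟨ cong (_+_ (+ 1 * (geomPow j (suc n) + geomPow (suc j) n)))
          (trans (⊗-congˡ (geomPow (suc j)) tail[1-x] n) (const-⊗ (- + 1) (geomPow (suc j)) n)) ⟩
    + 1 * (geomPow j (suc n) + geomPow (suc j) n) + - + 1 * geomPow (suc j) n
  ≡⟨ cancel (geomPow j (suc n)) (geomPow (suc j) n) ⟩
    geomPow j (suc n)
  ∎
  where
  open ≡-Reasoning
  tail[1-x] : tail (const (+ 1) ⊖ X) ≗ const (- + 1)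
  tail[1-x] zero    = refl
  tail[1-x] (suc m) = refl
  cancel : ∀ a b → + 1 * (a + b) + - + 1 * b ≡ a
  cancel = solve-∀

[1-x]^j⊗geomPow : ∀ j → (const (+ 1) ⊖ X) ^ˢ j ⊗ geomPow j ≗ const (+ 1)
[1-x]^j⊗geomPow zero    = ⊗-identityˡ (geomPow zero)
[1-x]^j⊗geomPow (suc j) = begin
  ((1-x) ⊗ (1-x) ^ˢ j) ⊗ geomPow (suc j)   ≈⟨ ⊗-congˡ (geomPow (suc j)) (⊗-comm (1-x) ((1-x) ^ˢ j)) ⟩
  ((1-x) ^ˢ j ⊗ (1-x)) ⊗ geomPow (suc j)   ≈⟨ ⊗-assoc ((1-x) ^ˢ j) (1-x) (geomPow (suc j)) ⟩
  (1-x) ^ˢ j ⊗ ((1-x) ⊗ geomPow (suc j))   ≈⟨ ⊗-congʳ ((1-x) ^ˢ j) ([1-x]⊗geomPow-suc j) ⟩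
  (1-x) ^ˢ j ⊗ geomPow j                   ≈⟨ [1-x]^j⊗geomPow j ⟩
  const (+ 1)                               ∎
  where
  open ≗-Reasoning
  1-x : Series
  1-x = const (+ 1) ⊖ X

inv-[1-x]^ : ∀ j → inv ((const (+ 1) ⊖ X) ^ˢ j) ≗ geomPow j
inv-[1-x]^ j = a⊗b≗1⇒inv-a≗b _ (geomPow j) (^ˢ-constant-term (const (+ 1) ⊖ X) j refl) ([1-x]^j⊗geomPow j)

-- Counting words

count : {A : Set} → (A → Bool) → List A → ℕ
count P xs = length (filterᵇ P xs)

module _ {A : Set} where

  count-++ : ∀ (P : A → Bool) xs ys → count P (xs ++ ys) ≡ count P xs ℕ.+ count P ys
  count-++ P xs ys = trans (cong length (List.filter-++ (T? ∘ P) xs ys)) (List.length-++ (filterᵇ P xs))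

  count-cong : ∀ {P Q : A → Bool} → P ≗ Q → ∀ xs → count P xs ≡ count Q xs
  count-cong {P} {Q} P≗Q xs = cong length (List.filter-≐ (T? ∘ P) (T? ∘ Q) P≐Q xs)
    where
    P≐Q : (T ∘ P) ≐ (T ∘ Q)
    P≐Q = (λ {x} → subst T (P≗Q x)) , (λ {x} → subst T (sym (P≗Q x)))

  count-false : ∀ (xs : List A) → count (λ _ → false) xs ≡ 0
  count-false []       = refl
  count-false (_ ∷ xs) = count-false xs

count-map : ∀ {A B : Set} (P : B → Bool) (f : A → B) xs → count P (map f xs) ≡ count (P ∘ f) xs
count-map P f []       = refl
count-map P f (x ∷ xs) with P (f x)
... | true  = cong suc (count-map P f xs)
... | false = count-map P f xs

count-concatMap-tabulate : ∀ {A B : Set} {m} (P : B → Bool) (f : A → List B) (g : Fin m → A) →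
                           + count P (concatMap f (tabulate g)) ≡ ∑[ i < m ] (+ count P (f (g i)))
count-concatMap-tabulate {m = zero}  P f g = refl
count-concatMap-tabulate {m = suc m} P f g = begin
    + count P (f (g fzero) ++ concatMap f (tabulate (g ∘ fsuc)))
  ≡⟨ cong +_ (count-++ P (f (g fzero)) _) ⟩
    + (count P (f (g fzero)) ℕ.+ count P (concatMap f (tabulate (g ∘ fsuc))))
  ≡⟨ ℤ.pos-+ (count P (f (g fzero))) _ ⟩
    + count P (f (g fzero)) + + count P (concatMap f (tabulate (g ∘ fsuc)))
  ≡⟨ cong (_+_ (+ count P (f (g fzero)))) (count-concatMap-tabulate P f (g ∘ fsuc)) ⟩
    + count P (f (g fzero)) + ∑[ i < m ] (+ count P (f (g (fsuc i))))
  ∎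
  where open ≡-Reasoning

count-allWords-suc : ∀ k n (P : Vec (Fin k) (suc n) → Bool) →
                     + count P (allWords k (suc n)) ≡ ∑[ x < k ] (+ count (P ∘ (x ∷ᵛ_)) (allWords k n))
count-allWords-suc k n P =
  trans (count-concatMap-tabulate P (λ x → map (x ∷ᵛ_) (allWords k n)) id)
        (sum-cong-≗ (λ x → cong +_ (count-map P (x ∷ᵛ_) (allWords k n))))

containsL-∷ : ∀ {k} τ (z : Fin k) w → containsL τ w ≡ true → containsL τ (z ∷ w) ≡ true
containsL-∷ []       z w       found = refl
containsL-∷ (b ∷ bs) z (y ∷ w) found rewrite found = ∨-zeroʳ _

containsL-rest : ∀ {k} b bs (y : Fin k) w → containsL (b ∷ bs) (y ∷ w) ≡ true → containsL bs w ≡ true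
containsL-rest b bs y (z ∷ w) found with matches b y z | containsL bs w in rest-found
... | _     | true  = containsL-∷ bs z w rest-found
... | true  | false = containsL-∷ bs z w (containsL-rest b bs z w found)
... | false | false = containsL-∷ bs z w (containsL-rest b bs z w found)

containsL-∨-rest : ∀ {k} b bs (y : Fin k) w → containsL bs w ∨ containsL (b ∷ bs) (y ∷ w) ≡ containsL bs w
containsL-∨-rest b bs y w with containsL bs w in rest-found
... | true  = refl
... | false with containsL (b ∷ bs) (y ∷ w) in found
...   | false = refl
...   | true with trans (sym rest-found) (containsL-rest b bs y w found)
...     | ()

nonMatchingCount : ∀ {k} → Block2 → Fin k → ℕ
nonMatchingCount     p12 x = suc (toℕ x)
nonMatchingCount {k} p21 x = k ∸ toℕ x

∑-reverse : ∀ k G → ∑[ y < k ] G (k ∸ toℕ y) ≡ ∑₁ k G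
∑-reverse zero    G = refl
∑-reverse (suc k) G = begin
  G (suc k) + ∑[ y < k ] G (k ∸ toℕ y)   ≡⟨ cong (_+_ (G (suc k))) (∑-reverse k G) ⟩
  G (suc k) + ∑₁ k G                     ≡⟨ ℤ.+-comm (G (suc k)) _ ⟩
  ∑₁ k G + G (suc k)                     ≡⟨ ∑₁-suc k G ⟨
  ∑₁ (suc k) G                           ∎
  where open ≡-Reasoning

∑-nonMatchingCount : ∀ k b G → ∑[ y < k ] G (nonMatchingCount b y) ≡ ∑₁ k G
∑-nonMatchingCount k p12 G = refl
∑-nonMatchingCount k p21 G = ∑-reverse k G

∑-nonMatching : ∀ {k} b (x : Fin k) G →
                ∑[ y < k ] (if matches b x y then + 0 else G (nonMatchingCount b y)) ≡ ∑₁ (nonMatchingCount b x) G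
∑-nonMatching {suc k} p12 fzero    G = cong (_+_ (G 1)) (sum-replicate-zero k)
∑-nonMatching {suc k} p12 (fsuc x) G = cong (_+_ (G 1)) (∑-nonMatching p12 x (G ∘ suc))
∑-nonMatching {suc k} p21 fzero    G = ∑-reverse (suc k) G
∑-nonMatching {suc k} p21 (fsuc x) G = trans (ℤ.+-identityˡ _) (∑-nonMatching p21 x G)

-- The transfer equations

module Transfer (k : ℕ) where

  avoidSeries : List Block2 → Series
  avoidSeries τ n = + avoidCount τ k n

  avoidSeriesAfter : List Block2 → Fin k → Series
  avoidSeriesAfter τ x n = + count (λ w → not (containsL τ (x ∷ toList w))) (allWords k n)

  avoidSeries-suc : ∀ τ n → avoidSeries τ (suc n) ≡ ∑[ x < k ] avoidSeriesAfter τ x n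
  avoidSeries-suc τ n = count-allWords-suc k n (avoids τ)

  avoidSeriesAfter-suc : ∀ b bs x n →
    avoidSeriesAfter (b ∷ bs) x (suc n) ≡
    ∑[ y < k ] (if matches b x y then avoidSeries bs n else avoidSeriesAfter (b ∷ bs) y n)
  avoidSeriesAfter-suc b bs x n = trans (count-allWords-suc k n _) (sum-cong-≗ first-two-letters)
    where
    first-two-letters : ∀ y →
      + count (λ w → not (containsL (b ∷ bs) (x ∷ y ∷ toList w))) (allWords k n) ≡
      (if matches b x y then avoidSeries bs n else avoidSeriesAfter (b ∷ bs) y n)
    first-two-letters y with matches b x y
    ... | true  = cong +_ (count-cong (λ w → cong not (containsL-∨-rest b bs y (toList w))) (allWords k n))
    ... | false = refl

  L : Series
  L = const (+ 1) ⊖ const (+ k) ⊗ X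

  H : Series → Series
  H f = const (+ 1) ⊖ L ⊗ f

  P : Series
  P = const (+ 1) ⊖ L ⊗ geomPow k

  L-0 : L 0 ≡ + 1
  L-0 = cong (_-_ (+ 1)) (ℤ.*-zeroʳ (+ k))

  tail-L : tail L ≗ const (- + k)
  tail-L m = trans (cong (_-_ (+ 0)) (const-⊗ (+ k) X (suc m))) (kX m)
    where
    kX : ∀ m → + 0 - + k * X (suc m) ≡ const (- + k) m
    kX zero    = trans (cong (_-_ (+ 0)) (ℤ.*-identityʳ (+ k))) (ℤ.+-identityˡ _)
    kX (suc m) = cong (_-_ (+ 0)) (ℤ.*-zeroʳ (+ k))

  L⊗-suc : ∀ f n → (L ⊗ f) (suc n) ≡ f (suc n) - + k * f n
  L⊗-suc f n = begin
    (L ⊗ f) (suc n)                        ≡⟨ ⊗-sucˡ L f n ⟩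
    L 0 * f (suc n) + (tail L ⊗ f) n       ≡⟨ cong₂ _+_ (cong (_* f (suc n)) L-0)
                                                        (trans (⊗-congˡ f tail-L n) (const-⊗ (- + k) f n)) ⟩
    + 1 * f (suc n) + - + k * f n          ≡⟨ rearrange (f (suc n)) (f n) (+ k) ⟩
    f (suc n) - + k * f n                  ∎
    where
    open ≡-Reasoning
    rearrange : ∀ a b c → + 1 * a + - c * b ≡ a - c * b
    rearrange = solve-∀

  H-0 : ∀ f → H f 0 ≡ + 1 - f 0
  H-0 f = cong (_-_ (+ 1)) (trans (cong (_* f 0) L-0) (ℤ.*-identityˡ (f 0)))

  H-suc : ∀ f n → H f (suc n) ≡ + k * f n - f (suc n)
  H-suc f n = trans (cong (_-_ (+ 0)) (L⊗-suc f n)) (negate (f (suc n)) (+ k * f n))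
    where
    negate : ∀ a b → + 0 - (a - b) ≡ b - a
    negate = solve-∀

  geomPow⊗H-0 : ∀ f j → f 0 + (geomPow j ⊗ H f) 0 ≡ + 1
  geomPow⊗H-0 f j = trans (cong₂ (λ c d → f 0 + c * d) (geomPow-0 j) (H-0 f)) (cancel (f 0))
    where
    cancel : ∀ a → a + + 1 * (+ 1 - a) ≡ + 1
    cancel = solve-∀

  geomPow⊗H-suc : ∀ f j n →
    + k * f n + ∑₁ j (λ i → (geomPow i ⊗ H f) n) ≡ f (suc n) + (geomPow j ⊗ H f) (suc n)
  geomPow⊗H-suc f j n = sym (begin
      f (suc n) + (geomPow j ⊗ H f) (suc n)
    ≡⟨ cong (_+_ (f (suc n))) (⊗-sucˡ (geomPow j) (H f) n) ⟩
      f (suc n) + (geomPow j 0 * H f (suc n) + (tail (geomPow j) ⊗ H f) n)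
    ≡⟨ cong (_+_ (f (suc n))) (cong₂ _+_ (cong₂ _*_ (geomPow-0 j) (H-suc f n))
                                         (⊗-congˡ (H f) (geomPow-suc j) n)) ⟩
      f (suc n) + (+ 1 * (+ k * f n - f (suc n)) + ((λ m → ∑₁ j (λ i → geomPow i m)) ⊗ H f) n)
    ≡⟨ cong (λ s → f (suc n) + (+ 1 * (+ k * f n - f (suc n)) + s)) (∑₁-⊗ j geomPow (H f) n) ⟩
      f (suc n) + (+ 1 * (+ k * f n - f (suc n)) + ∑₁ j (λ i → (geomPow i ⊗ H f) n))
    ≡⟨ cancel (f (suc n)) (+ k * f n) _ ⟩
      + k * f n + ∑₁ j (λ i → (geomPow i ⊗ H f) n)
    ∎)
    where
    open ≡-Reasoning
    cancel : ∀ a b s → a + (+ 1 * (b - a) + s) ≡ b + s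
    cancel = solve-∀

  module _ (b : Block2) (bs : List Block2) where

    private
      A : Series
      A = avoidSeries bs
      G : ℕ → ℕ → ℤ
      G n i = (geomPow i ⊗ H A) n

    avoidSeriesAfter-∷ : ∀ n x → avoidSeriesAfter (b ∷ bs) x n ≡ A n + (geomPow (nonMatchingCount b x) ⊗ H A) n
    avoidSeriesAfter-∷ zero    x = sym (geomPow⊗H-0 A (nonMatchingCount b x))
    avoidSeriesAfter-∷ (suc n) x = begin
        avoidSeriesAfter (b ∷ bs) x (suc n)
      ≡⟨ avoidSeriesAfter-suc b bs x n ⟩
        ∑[ y < k ] (if matches b x y then A n else avoidSeriesAfter (b ∷ bs) y n)
      ≡⟨ sum-cong-≗ split ⟩
        ∑[ y < k ] (A n + (if matches b x y then + 0 else G n (nonMatchingCount b y)))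
      ≡⟨ ∑-split k (A n) _ ⟩
        + k * A n + ∑[ y < k ] (if matches b x y then + 0 else G n (nonMatchingCount b y))
      ≡⟨ cong (_+_ (+ k * A n)) (∑-nonMatching b x (G n)) ⟩
        + k * A n + ∑₁ (nonMatchingCount b x) (G n)
      ≡⟨ geomPow⊗H-suc A (nonMatchingCount b x) n ⟩
        A (suc n) + (geomPow (nonMatchingCount b x) ⊗ H A) (suc n)
      ∎
      where
      open ≡-Reasoning
      split : ∀ y → (if matches b x y then A n else avoidSeriesAfter (b ∷ bs) y n) ≡
                    A n + (if matches b x y then + 0 else G n (nonMatchingCount b y))
      split y with matches b x y
      ... | true  = sym (ℤ.+-identityʳ (A n))
      ... | false = avoidSeriesAfter-∷ n y

    avoidSeries-∷ : avoidSeries (b ∷ bs) ≗ A ⊕ geomPow k ⊗ H A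
    avoidSeries-∷ zero    = sym (geomPow⊗H-0 A k)
    avoidSeries-∷ (suc n) = begin
      avoidSeries (b ∷ bs) (suc n)                       ≡⟨ avoidSeries-suc (b ∷ bs) n ⟩
      ∑[ x < k ] avoidSeriesAfter (b ∷ bs) x n           ≡⟨ sum-cong-≗ (avoidSeriesAfter-∷ n) ⟩
      ∑[ x < k ] (A n + G n (nonMatchingCount b x))      ≡⟨ ∑-split k (A n) _ ⟩
      + k * A n + ∑[ x < k ] G n (nonMatchingCount b x)  ≡⟨ cong (_+_ (+ k * A n)) (∑-nonMatchingCount k b (G n)) ⟩
      + k * A n + ∑₁ k (G n)                             ≡⟨ geomPow⊗H-suc A k n ⟩
      A (suc n) + (geomPow k ⊗ H A) (suc n)              ∎
      where open ≡-Reasoning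

    H-∷ : H (avoidSeries (b ∷ bs)) ≗ P ⊗ H A
    H-∷ = begin
        const (+ 1) ⊖ L ⊗ avoidSeries (b ∷ bs)
      ≈⟨ ⊖-congʳ (const (+ 1)) (⊗-congʳ L avoidSeries-∷) ⟩
        const (+ 1) ⊖ L ⊗ (A ⊕ geomPow k ⊗ H A)
      ≈⟨ ⊖-congʳ (const (+ 1)) (⊗-distribˡ-⊕ L A (geomPow k ⊗ H A)) ⟩
        const (+ 1) ⊖ (L ⊗ A ⊕ L ⊗ (geomPow k ⊗ H A))
      ≈⟨ (λ n → regroup (const (+ 1) n) ((L ⊗ A) n) _) ⟩
        H A ⊖ L ⊗ (geomPow k ⊗ H A)
      ≈⟨ ⊖-cong (⊗-identityˡ (H A)) (⊗-assoc L (geomPow k) (H A)) ⟨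
        const (+ 1) ⊗ H A ⊖ (L ⊗ geomPow k) ⊗ H A
      ≈⟨ ⊗-distribʳ-⊖ (const (+ 1)) (L ⊗ geomPow k) (H A) ⟨
        P ⊗ H A
      ∎
      where
      open ≗-Reasoning
      regroup : ∀ a b c → a - (b + c) ≡ a - b - c
      regroup = solve-∀

  H-[] : H (avoidSeries []) ≗ const (+ 1)
  H-[] n = begin
    const (+ 1) n - (L ⊗ avoidSeries []) n     ≡⟨ cong (_-_ (const (+ 1) n)) (⊗-congʳ L avoidSeries-[] n) ⟩
    const (+ 1) n - (L ⊗ (λ _ → + 0)) n        ≡⟨ cong (_-_ (const (+ 1) n)) (⊗-comm L (λ _ → + 0) n) ⟩
    const (+ 1) n - ((λ _ → + 0) ⊗ L) n        ≡⟨ cong (_-_ (const (+ 1) n)) (⊗-zeroˡ L n) ⟩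
    const (+ 1) n - + 0                        ≡⟨ ℤ.+-identityʳ (const (+ 1) n) ⟩
    const (+ 1) n                              ∎
    where
    open ≡-Reasoning
    avoidSeries-[] : avoidSeries [] ≗ (λ _ → + 0)
    avoidSeries-[] n = cong +_ (count-false (allWords k n))

  H-avoidSeries : ∀ τ → H (avoidSeries τ) ≗ P ^ˢ length τ
  H-avoidSeries []       = H-[]
  H-avoidSeries (b ∷ bs) n = trans (H-∷ b bs n) (⊗-congʳ P (H-avoidSeries bs) n)

  L⊗avoidSeries : ∀ τ → L ⊗ avoidSeries τ ≗ const (+ 1) ⊖ P ^ˢ length τ
  L⊗avoidSeries τ n = trans (sym (cancel (const (+ 1) n) _)) (cong (_-_ (const (+ 1) n)) (H-avoidSeries τ n))
    where
    cancel : ∀ a b → a - (a - b) ≡ b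
    cancel = solve-∀

  avoidSeries-closedForm : ∀ τ → avoidSeries τ ≗ (const (+ 1) ⊖ P ^ˢ length τ) ⊗ inv L
  avoidSeries-closedForm τ = a⊗f≗g⇒f≗g⊗inv-a L (avoidSeries τ) _ L-0 (L⊗avoidSeries τ)

  P≗1+[kx-1]⊗inv[1-x]^k : P ≗ const (+ 1) ⊕ (const (+ k) ⊗ X ⊖ const (+ 1)) ⊗ inv ((const (+ 1) ⊖ X) ^ˢ k)
  P≗1+[kx-1]⊗inv[1-x]^k = begin
      const (+ 1) ⊖ (const (+ 1) ⊖ kx) ⊗ geomPow k
    ≈⟨ ⊖-congʳ (const (+ 1)) (⊗-distribʳ-⊖ (const (+ 1)) kx (geomPow k)) ⟩
      const (+ 1) ⊖ (const (+ 1) ⊗ geomPow k ⊖ kx ⊗ geomPow k)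
    ≈⟨ (λ n → swap (const (+ 1) n) ((const (+ 1) ⊗ geomPow k) n) _) ⟩
      const (+ 1) ⊕ (kx ⊗ geomPow k ⊖ const (+ 1) ⊗ geomPow k)
    ≈⟨ ⊕-congʳ (const (+ 1)) (⊗-distribʳ-⊖ kx (const (+ 1)) (geomPow k)) ⟨
      const (+ 1) ⊕ (kx ⊖ const (+ 1)) ⊗ geomPow k
    ≈⟨ ⊕-congʳ (const (+ 1)) (⊗-congʳ (kx ⊖ const (+ 1)) (inv-[1-x]^ k)) ⟨
      const (+ 1) ⊕ (kx ⊖ const (+ 1)) ⊗ inv ((const (+ 1) ⊖ X) ^ˢ k)
    ∎
    where
    open ≗-Reasoning
    kx : Series
    kx = const (+ k) ⊗ X
    swap : ∀ a b c → a - (b - c) ≡ a + (c - b)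
    swap = solve-∀

-- The identity holds for s = 0 and k = 0 as well.
mainTheorem11 : (τ : List Block2) → 1 ≤ length τ → (k : ℕ) → 1 ≤ k → (n : ℕ) →
    + avoidCount τ k n ≡
      ((const (+ 1) ⊖ ((const (+ 1) ⊕ ((const (+ k) ⊗ X) ⊖ const (+ 1)) ⊗ inv ((const (+ 1) ⊖ X) ^ˢ k)) ^ˢ length τ))
        ⊗ inv (const (+ 1) ⊖ (const (+ k) ⊗ X))) n
mainTheorem11 τ _ k _ n =
  trans (avoidSeries-closedForm τ n)
        (⊗-congˡ (inv L) (⊖-congʳ (const (+ 1)) (^ˢ-cong (length τ) P≗1+[kx-1]⊗inv[1-x]^k)) n)
  where open Transfer k
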